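{- Let $m$, $n$ and $r$ be non-negative integers. If $\{(s_k),(\sigma_k)\}$ and $\{(t_k),(\tau_k)\}$, $k=0,1,2,\ldots$, are binomial-transform pairs of the first kind, then \[ \sum_{k=0}^n (-1)^k\binom nk s_{n-k+m}\sum_{q=0}^r(-1)^q\binom rq \tau_{k+q} = \sum_{k=0}^n(-1)^k\binom nk t_{n-k+r}\sum_{p=0}^m(-1)^p\binom mp\sigma_{k+p}. \]
   Context: Two sequences $(s_k)_{k\ge0}$ and $(\sigma_k)_{k\ge0}$ of complex numbers form a binomial-transform pair of the first kind if $\sigma_n=\sum_{k=0}^n(-1)^k\binom nk s_k$ for every non-negative integer $n$. -}

module Defs where

open import Level using (Level)
open import Data.Nat using (ℕ; zero; suc)
open import Data.Nat.Combinatorics using (_C_)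
open import Algebra.Bundles using (CommutativeRing)

-- Generic finite-sum / binomial notions over an arbitrary commutative ring R
-- (standing in for the complex numbers, which agda-stdlib does not have).
module _ {c ℓ : Level} (R : CommutativeRing c ℓ) where
  open CommutativeRing R

  natR : ℕ → Carrier
  natR zero    = 0#
  natR (suc n) = 1# + natR n

  powR : Carrier → ℕ → Carrier
  powR x zero    = 1#
  powR x (suc k) = x * powR x k

  neg1^ : ℕ → Carrier
  neg1^ k = powR (- 1#) k

  sumTo : ℕ → (ℕ → Carrier) → Carrier
  sumTo zero    f = f 0
  sumTo (suc n) f = sumTo n f + f (suc n)

  IsBinomialPair : (ℕ → Carrier) → (ℕ → Carrier) → Set ℓ
  IsBinomialPair s σ =
    ∀ n → σ n ≈ sumTo n (λ k → neg1^ k * natR (n C k) * s k)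

{-# OPTIONS --safe #-}
-- Let (u ⋆ v) n = Σ_k C(n,k) u_{n-k} v_k be the binomial convolution (the product of exponential
-- generating functions) and T b k = (-1)^k Σ_j (-1)^j C(k,j) b_j the signed transform, whose
-- generating function is e^{-x} times that of b.  For a pair (t, τ) the inner sum
-- Σ_q (-1)^q C(r,q) τ_{k+q} equals Σ_j (-1)^j C(k,j) t_{j+r}: as tables in (r, k) both obey
-- F(r+1,k) = F(r,k) - F(r,k+1) and agree at r = 0.  Hence the left-hand side is (s_{·+m} ⋆ T t_{·+r}) n,
-- the right-hand side is (t_{·+r} ⋆ T s_{·+m}) n, and a ⋆ T b is symmetric in a and b (its generating
-- function is e^{-x} A B).
module Submission where

open import Defs
open import Level using (Level)
open import Data.Nat using (ℕ; _+_; _∸_)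
open import Data.Nat.Combinatorics using (_C_)
open import Algebra.Bundles using (CommutativeRing)

open import Data.Nat using (zero; suc; _≤_; z≤n)
import Data.Nat.Properties as ℕ
open import Data.Nat.Combinatorics using (nCk+nC[k+1]≡[n+1]C[k+1]; k>n⇒nCk≡0)
import Relation.Binary.PropositionalEquality as ≡
import Algebra.Properties.Group as GroupProperties
import Algebra.Properties.Ring as RingProperties
import Algebra.Solver.Ring.NaturalCoefficients.Default as SemiringSolver
import Relation.Binary.Reasoning.Setoid as SetoidReasoning

infixl 10 _⁺
_⁺ : ∀ {a} {A : Set a} → (ℕ → A) → ℕ → A
(f ⁺) i = f (suc i)

module BinomialTransform {c ℓ : Level} (R : CommutativeRing c ℓ) where
  open CommutativeRing R renaming (_+_ to _+R_)
  open SetoidReasoning setoid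
  open SemiringSolver commutativeSemiring using (solve; _:+_; _:*_; _:=_)
  open GroupProperties +-group using (∙-cancelʳ)
  open RingProperties ring using (-1*x≈-x)

  sumTo-cong-≤ : ∀ n {f g : ℕ → Carrier} → (∀ k → k ≤ n → f k ≈ g k) → sumTo R n f ≈ sumTo R n g
  sumTo-cong-≤ zero    f≈g = f≈g 0 z≤n
  sumTo-cong-≤ (suc n) f≈g =
    +-cong (sumTo-cong-≤ n (λ k k≤n → f≈g k (ℕ.m≤n⇒m≤1+n k≤n))) (f≈g (suc n) ℕ.≤-refl)

  sumTo-cong : ∀ n {f g : ℕ → Carrier} → (∀ k → f k ≈ g k) → sumTo R n f ≈ sumTo R n g
  sumTo-cong n f≈g = sumTo-cong-≤ n (λ k _ → f≈g k)

  sumTo-+ : ∀ n (f g : ℕ → Carrier) → sumTo R n (λ k → f k +R g k) ≈ sumTo R n f +R sumTo R n g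
  sumTo-+ zero    f g = refl
  sumTo-+ (suc n) f g = begin
    sumTo R n (λ k → f k +R g k) +R (f (suc n) +R g (suc n))
      ≈⟨ +-congʳ (sumTo-+ n f g) ⟩
    (sumTo R n f +R sumTo R n g) +R (f (suc n) +R g (suc n))
      ≈⟨ solve 4 (λ a b x y → (a :+ b) :+ (x :+ y) := (a :+ x) :+ (b :+ y)) refl _ _ _ _ ⟩
    (sumTo R n f +R f (suc n)) +R (sumTo R n g +R g (suc n)) ∎

  sumTo-zero : ∀ n {f : ℕ → Carrier} → (∀ k → f k ≈ 0#) → sumTo R n f ≈ 0#
  sumTo-zero zero    f≈0 = f≈0 0
  sumTo-zero (suc n) f≈0 = trans (+-cong (sumTo-zero n f≈0) (f≈0 (suc n))) (+-identityʳ 0#)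

  sumTo-suc-head : ∀ n (f : ℕ → Carrier) → sumTo R (suc n) f ≈ f 0 +R sumTo R n (f ⁺)
  sumTo-suc-head zero    f = refl
  sumTo-suc-head (suc n) f = trans (+-congʳ (sumTo-suc-head n f)) (+-assoc _ _ _)

  natR-+ : ∀ a b → natR R (a + b) ≈ natR R a +R natR R b
  natR-+ zero    b = sym (+-identityˡ _)
  natR-+ (suc a) b = trans (+-congˡ (natR-+ a b)) (sym (+-assoc _ _ _))

  natR-pascal : ∀ n k → natR R (suc n C suc k) ≈ natR R (n C k) +R natR R (n C suc k)
  natR-pascal n k = trans (reflexive (≡.cong (natR R) (≡.sym (nCk+nC[k+1]≡[n+1]C[k+1] n k))))
                          (natR-+ (n C k) (n C suc k))

  natR-C-suc-self : ∀ n → natR R (n C suc n) ≈ 0#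
  natR-C-suc-self n = reflexive (≡.cong (natR R) (k>n⇒nCk≡0 (ℕ.n<1+n n)))

  neg1^-suc-cancel : ∀ k x → neg1^ R (suc k) * x +R neg1^ R k * x ≈ 0#
  neg1^-suc-cancel k x = begin
    - 1# * neg1^ R k * x +R neg1^ R k * x ≈⟨ +-congʳ (trans (*-assoc _ _ _) (-1*x≈-x _)) ⟩
    - (neg1^ R k * x) +R neg1^ R k * x   ≈⟨ -‿inverseˡ _ ⟩
    0# ∎

  infixl 7 _⋆_
  _⋆_ : (ℕ → Carrier) → (ℕ → Carrier) → ℕ → Carrier
  (u ⋆ v) n = sumTo R n (λ k → natR R (n C k) * u (n ∸ k) * v k)

  ⋆-zero : ∀ u v → (u ⋆ v) 0 ≈ u 0 * v 0
  ⋆-zero u v = *-congʳ (trans (*-congʳ (+-identityʳ 1#)) (*-identityˡ (u 0)))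

  ⋆-congʳ : ∀ u {v w} n → (∀ k → v k ≈ w k) → (u ⋆ v) n ≈ (u ⋆ w) n
  ⋆-congʳ u n v≈w = sumTo-cong n (λ k → *-congˡ (v≈w k))

  ⋆-distribˡ-+ : ∀ u v w n → (u ⋆ (λ k → v k +R w k)) n ≈ (u ⋆ v) n +R (u ⋆ w) n
  ⋆-distribˡ-+ u v w n = trans (sumTo-cong n (λ k → distribˡ _ _ _)) (sumTo-+ n _ _)

  ⋆-top-vanishes : ∀ u v n →
    sumTo R (suc n) (λ k → natR R (n C k) * u (suc n ∸ k) * v k) ≈ (u ⁺ ⋆ v) n
  ⋆-top-vanishes u v n = begin
    sumTo R n (λ k → natR R (n C k) * u (suc n ∸ k) * v k) +R natR R (n C suc n) * u (n ∸ n) * v (suc n)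
      ≈⟨ +-cong (sumTo-cong-≤ n λ k k≤n → *-congʳ (*-congˡ (reflexive (≡.cong u (ℕ.+-∸-assoc 1 k≤n)))))
                (trans (*-congʳ (trans (*-congʳ (natR-C-suc-self n)) (zeroˡ _))) (zeroˡ _)) ⟩
    (u ⁺ ⋆ v) n +R 0#
      ≈⟨ +-identityʳ _ ⟩
    (u ⁺ ⋆ v) n ∎

  ⋆-suc : ∀ u v n → (u ⋆ v) (suc n) ≈ (u ⁺ ⋆ v) n +R (u ⋆ v ⁺) n
  ⋆-suc u v n = begin
    (u ⋆ v) (suc n)
      ≈⟨ sumTo-suc-head n _ ⟩
    lead +R sumTo R n (λ k → natR R (suc n C suc k) * u (n ∸ k) * v (suc k))
      ≈⟨ +-congˡ (trans (sumTo-cong n pascal-split) (sumTo-+ n _ _)) ⟩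
    lead +R (sumTo R n (λ k → natR R (n C suc k) * u (n ∸ k) * v (suc k)) +R (u ⋆ v ⁺) n)
      ≈⟨ +-assoc _ _ _ ⟨
    (lead +R sumTo R n (λ k → natR R (n C suc k) * u (n ∸ k) * v (suc k))) +R (u ⋆ v ⁺) n
      ≈⟨ +-congʳ (trans (sym (sumTo-suc-head n _)) (⋆-top-vanishes u v n)) ⟩
    (u ⁺ ⋆ v) n +R (u ⋆ v ⁺) n ∎
    where
    lead : Carrier
    lead = natR R (n C 0) * u (suc n) * v 0
    pascal-split : ∀ k → natR R (suc n C suc k) * u (n ∸ k) * v (suc k)
                       ≈ natR R (n C suc k) * u (n ∸ k) * v (suc k) +R natR R (n C k) * u (n ∸ k) * v (suc k)
    pascal-split k = begin
      natR R (suc n C suc k) * u (n ∸ k) * v (suc k)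
        ≈⟨ *-congʳ (*-congʳ (trans (natR-pascal n k) (+-comm _ _))) ⟩
      (natR R (n C suc k) +R natR R (n C k)) * u (n ∸ k) * v (suc k)
        ≈⟨ trans (*-congʳ (distribʳ _ _ _)) (distribʳ _ _ _) ⟩
      natR R (n C suc k) * u (n ∸ k) * v (suc k) +R natR R (n C k) * u (n ∸ k) * v (suc k) ∎

  binomialTransform : (ℕ → Carrier) → ℕ → Carrier
  binomialTransform f n = sumTo R n (λ k → neg1^ R k * natR R (n C k) * f k)

  binomialTransform-cong : ∀ n {f g : ℕ → Carrier} → (∀ k → f k ≈ g k) →
                           binomialTransform f n ≈ binomialTransform g n
  binomialTransform-cong n f≈g = sumTo-cong n (λ k → *-congˡ (f≈g k))

  binomialTransform-zero : ∀ f → binomialTransform f 0 ≈ f 0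
  binomialTransform-zero f = trans (*-congʳ (trans (*-identityˡ _) (+-identityʳ 1#))) (*-identityˡ (f 0))

  binomialTransform≈⋆ : ∀ f n → binomialTransform f n ≈ ((λ _ → 1#) ⋆ (λ k → neg1^ R k * f k)) n
  binomialTransform≈⋆ f n = sumTo-cong n λ k →
    trans (solve 3 (λ e c x → e :* c :* x := c :* (e :* x)) refl _ _ _) (sym (*-congʳ (*-identityʳ _)))

  binomialTransform-suc : ∀ f n →
    binomialTransform f (suc n) +R binomialTransform (f ⁺) n ≈ binomialTransform f n
  binomialTransform-suc f n = begin
    binomialTransform f (suc n) +R binomialTransform (f ⁺) n
      ≈⟨ +-congʳ (trans (binomialTransform≈⋆ f (suc n)) (⋆-suc one g n)) ⟩
    ((one ⋆ g) n +R (one ⋆ g ⁺) n) +R binomialTransform (f ⁺) n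
      ≈⟨ +-assoc _ _ _ ⟩
    (one ⋆ g) n +R ((one ⋆ g ⁺) n +R binomialTransform (f ⁺) n)
      ≈⟨ +-congˡ (trans (sym (sumTo-+ n _ _)) (sumTo-zero n cancel)) ⟩
    (one ⋆ g) n +R 0#
      ≈⟨ +-identityʳ _ ⟩
    (one ⋆ g) n
      ≈⟨ binomialTransform≈⋆ f n ⟨
    binomialTransform f n ∎
    where
    one g : ℕ → Carrier
    one _ = 1#
    g k = neg1^ R k * f k
    cancel : ∀ k → natR R (n C k) * 1# * g (suc k) +R neg1^ R k * natR R (n C k) * f (suc k) ≈ 0#
    cancel k = trans (+-cong (trans (*-congʳ (*-identityʳ _))
                                    (solve 3 (λ c e x → c :* (e :* x) := e :* (c :* x)) refl _ _ _))
                             (*-assoc _ _ _))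
                     (neg1^-suc-cancel k (natR R (n C k) * f (suc k)))

  signedTransform : (ℕ → Carrier) → ℕ → Carrier
  signedTransform f k = neg1^ R k * binomialTransform f k

  signedTransform-zero : ∀ f → signedTransform f 0 ≈ f 0
  signedTransform-zero f = trans (*-identityˡ _) (binomialTransform-zero f)

  signedTransform-suc : ∀ f k →
    signedTransform f (suc k) +R signedTransform f k ≈ signedTransform (f ⁺) k
  signedTransform-suc f k = begin
    neg1^ R (suc k) * β +R neg1^ R k * binomialTransform f k
      ≈⟨ +-congˡ (*-congˡ (binomialTransform-suc f k)) ⟨
    neg1^ R (suc k) * β +R neg1^ R k * (β +R γ)
      ≈⟨ trans (+-congˡ (distribˡ _ _ _)) (sym (+-assoc _ _ _)) ⟩
    (neg1^ R (suc k) * β +R neg1^ R k * β) +R neg1^ R k * γ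
      ≈⟨ +-congʳ (neg1^-suc-cancel k β) ⟩
    0# +R neg1^ R k * γ
      ≈⟨ +-identityˡ _ ⟩
    neg1^ R k * γ ∎
    where
    β γ : Carrier
    β = binomialTransform f (suc k)
    γ = binomialTransform (f ⁺) k

  ⋆-signedTransform-suc : ∀ a b n →
    (a ⋆ signedTransform b) (suc n) +R (a ⋆ signedTransform b) n
      ≈ (a ⁺ ⋆ signedTransform b) n +R (a ⋆ signedTransform (b ⁺)) n
  ⋆-signedTransform-suc a b n = begin
    (a ⋆ signedTransform b) (suc n) +R (a ⋆ signedTransform b) n
      ≈⟨ +-congʳ (⋆-suc a (signedTransform b) n) ⟩
    ((a ⁺ ⋆ signedTransform b) n +R (a ⋆ (signedTransform b ⁺)) n) +R (a ⋆ signedTransform b) n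
      ≈⟨ +-assoc _ _ _ ⟩
    (a ⁺ ⋆ signedTransform b) n +R ((a ⋆ (signedTransform b ⁺)) n +R (a ⋆ signedTransform b) n)
      ≈⟨ +-congˡ (trans (sym (⋆-distribˡ-+ a _ _ n)) (⋆-congʳ a n (signedTransform-suc b))) ⟩
    (a ⁺ ⋆ signedTransform b) n +R (a ⋆ signedTransform (b ⁺)) n ∎

  ⋆-signedTransform-comm : ∀ n a b → (a ⋆ signedTransform b) n ≈ (b ⋆ signedTransform a) n
  ⋆-signedTransform-comm zero a b = begin
    (a ⋆ signedTransform b) 0 ≈⟨ trans (⋆-zero a (signedTransform b)) (*-congˡ (signedTransform-zero b)) ⟩
    a 0 * b 0                 ≈⟨ *-comm _ _ ⟩
    b 0 * a 0                 ≈⟨ trans (⋆-zero b (signedTransform a)) (*-congˡ (signedTransform-zero a)) ⟨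
    (b ⋆ signedTransform a) 0 ∎
  ⋆-signedTransform-comm (suc n) a b = ∙-cancelʳ ((a ⋆ signedTransform b) n) _ _ (begin
    (a ⋆ signedTransform b) (suc n) +R (a ⋆ signedTransform b) n
      ≈⟨ ⋆-signedTransform-suc a b n ⟩
    (a ⁺ ⋆ signedTransform b) n +R (a ⋆ signedTransform (b ⁺)) n
      ≈⟨ +-comm _ _ ⟩
    (a ⋆ signedTransform (b ⁺)) n +R (a ⁺ ⋆ signedTransform b) n
      ≈⟨ +-cong (⋆-signedTransform-comm n a (b ⁺)) (⋆-signedTransform-comm n (a ⁺) b) ⟩
    (b ⁺ ⋆ signedTransform a) n +R (b ⋆ signedTransform (a ⁺)) n
      ≈⟨ ⋆-signedTransform-suc b a n ⟨
    (b ⋆ signedTransform a) (suc n) +R (b ⋆ signedTransform a) n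
      ≈⟨ +-congˡ (⋆-signedTransform-comm n b a) ⟩
    (b ⋆ signedTransform a) (suc n) +R (a ⋆ signedTransform b) n ∎)

  IsDifferenceTable : (ℕ → ℕ → Carrier) → Set ℓ
  IsDifferenceTable F = ∀ r k → F (suc r) k +R F r (suc k) ≈ F r k

  differenceTable-unique : ∀ {F G} → IsDifferenceTable F → IsDifferenceTable G →
                           (∀ k → F 0 k ≈ G 0 k) → ∀ r k → F r k ≈ G r k
  differenceTable-unique F-table G-table F₀≈G₀ zero    k = F₀≈G₀ k
  differenceTable-unique {F} {G} F-table G-table F₀≈G₀ (suc r) k = ∙-cancelʳ (F r (suc k)) _ _ (begin
    F (suc r) k +R F r (suc k) ≈⟨ F-table r k ⟩
    F r k                      ≈⟨ F≈G k ⟩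
    G r k                      ≈⟨ G-table r k ⟨
    G (suc r) k +R G r (suc k) ≈⟨ +-congˡ (F≈G (suc k)) ⟨
    G (suc r) k +R F r (suc k) ∎)
    where F≈G = differenceTable-unique F-table G-table F₀≈G₀ r

  binomialPair-shift : ∀ {t τ} → IsBinomialPair R t τ → ∀ r k →
    binomialTransform (λ q → τ (k + q)) r ≈ binomialTransform (λ j → t (j + r)) k
  binomialPair-shift {t} {τ} t↦τ = differenceTable-unique F-table G-table first-row
    where
    F G : ℕ → ℕ → Carrier
    F r k = binomialTransform (λ q → τ (k + q)) r
    G r k = binomialTransform (λ j → t (j + r)) k

    F-table : IsDifferenceTable F
    F-table r k = trans (+-congˡ (binomialTransform-cong r λ q → reflexive (≡.cong τ (≡.sym (ℕ.+-suc k q)))))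
                        (binomialTransform-suc (λ q → τ (k + q)) r)

    G-table : IsDifferenceTable G
    G-table r k = trans (+-comm _ _)
                        (trans (+-congˡ (binomialTransform-cong k λ j → reflexive (≡.cong t (ℕ.+-suc j r))))
                               (binomialTransform-suc (λ j → t (j + r)) k))

    first-row : ∀ k → F 0 k ≈ G 0 k
    first-row k = begin
      F 0 k
        ≈⟨ binomialTransform-zero (λ q → τ (k + q)) ⟩
      τ (k + 0)
        ≈⟨ reflexive (≡.cong τ (ℕ.+-identityʳ k)) ⟩
      τ k
        ≈⟨ t↦τ k ⟩
      binomialTransform t k
        ≈⟨ binomialTransform-cong k (λ j → reflexive (≡.cong t (≡.sym (ℕ.+-identityʳ j)))) ⟩
      G 0 k ∎

  doubleSum≈⋆ : ∀ m n r (s t τ : ℕ → Carrier) → IsBinomialPair R t τ →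
    sumTo R n (λ k → neg1^ R k * natR R (n C k) * s (n ∸ k + m) * binomialTransform (λ q → τ (k + q)) r)
      ≈ ((λ i → s (i + m)) ⋆ signedTransform (λ j → t (j + r))) n
  doubleSum≈⋆ m n r s t τ t↦τ = sumTo-cong n λ k →
    trans (*-congˡ (binomialPair-shift t↦τ r k))
          (solve 4 (λ e c x y → e :* c :* x :* y := c :* x :* (e :* y)) refl _ _ _ _)

theorem11 : {c ℓ : Level} (R : CommutativeRing c ℓ) →
    let open CommutativeRing R renaming (_+_ to _+R_) in
    (m n r : ℕ) (s σ t τ : ℕ → Carrier) →
    IsBinomialPair R s σ → IsBinomialPair R t τ →
    sumTo R n (λ k → neg1^ R k * natR R (n C k) * s (n ∸ k + m)
        * sumTo R r (λ q → neg1^ R q * natR R (r C q) * τ (k + q)))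
    ≈ sumTo R n (λ k → neg1^ R k * natR R (n C k) * t (n ∸ k + r)
        * sumTo R m (λ p → neg1^ R p * natR R (m C p) * σ (k + p)))
theorem11 R m n r s σ t τ s↦σ t↦τ = begin
  _ ≈⟨ doubleSum≈⋆ m n r s t τ t↦τ ⟩
  ((λ i → s (i + m)) ⋆ signedTransform (λ j → t (j + r))) n ≈⟨ ⋆-signedTransform-comm n _ _ ⟩
  ((λ j → t (j + r)) ⋆ signedTransform (λ i → s (i + m))) n ≈⟨ doubleSum≈⋆ r n m t s σ s↦σ ⟨
  _ ∎
  where
  open BinomialTransform R
  open CommutativeRing R using (setoid)
  open SetoidReasoning setoid
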